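{- Let $D$ be a diagram and $i,c\ge1$, and suppose $L_{i,c}$ acts initially on $D$ and moves at least one cell. Let $(r_1,c),\dots,(r_k,c)$ with $r_1<\dots<r_k$ be the cells moved by $L_{i,c}$, and set $r_0=i$. Then for each $j\in\{1,\dots,k\}$ the cell $(r_j,c)$ is moved to $(r_{j-1},c+1)$. Consequently $\mathrm{wt}(L_{i,c}(D))$ is obtained from $\mathrm{wt}(D)$ by adding $1$ to its $i$-th entry.
   Context: A diagram is a finite subset of $\mathbb{Z}_{>0}\times\mathbb{Z}_{>0}$; $(r,c)$ is the cell in row $r$ (row 1 on top), column $c$; $\mathrm{wt}(D)$ is the sequence whose $i$-th entry is the number of cells of $D$ in row $i$. Ladder moves. Let $D$ be a diagram, $i\ge1$, $(r,c)\in D$. A ladder move below row $i$ can be performed at $(r,c)$ if $(r,c+1)\notin D$ and there is $r'$ with $i\le r'<r$ such that $(r',c)\notin D$, $(r',c+1)\notin D$ and $(s,c),(s,c+1)\in D$ for all $r'<s<r$ (such $r'$ is unique). The regular ladder move replaces $D$ by $(D\setminus\{(r,c)\})\cup\{(r',c+1)\}$; the K-ladder move replaces $D$ by $D\cup\{(r',c+1)\}$; in both cases we say $(r,c)$ is moved to $(r',c+1)$. Operator $L_{i,c}$. Given $D$, scan the cells of column $c$ in rows $\ge i$ from top to bottom (in the current diagram); whenever the current cell admits a ladder move below row $i$, perform the regular ladder move. After finishing the column, if at least one move was performed, turn the last one into a K-ladder move. The result is $L_{i,c}(D)$; the cells moved by $L_{i,c}$ are the cells at which these moves were performed. $L_{i,c}$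 acts initially on $D$ if $L_{i+1,c}(D)=D$. -}

module Defs where

open import Data.Nat using (ℕ; zero; suc; _+_; _∸_; _≤_; _⊔_; _≡ᵇ_)
open import Data.Bool using (Bool; true; false; _∧_; not; if_then_else_)
open import Data.List using (List; []; _∷_; _++_; filter; length; applyUpTo; foldr)
open import Data.Bool.ListAction using (any)
open import Data.Maybe using (Maybe; just; nothing)
open import Data.Product using (_×_; _,_; proj₁; proj₂)
open import Data.Unit using (⊤)
open import Data.List.Relation.Unary.All using (All)
open import Relation.Binary.PropositionalEquality using (_≡_)
open import Relation.Nullary.Decidable using (does)
open import Data.Nat.Properties using (_≟_)

-- A cell (r , c): row r (row 1 on top), column c.
Cell : Set
Cell = ℕ × ℕ

-- A diagram is a finite set of cells, represented by a list of cells
-- (duplicates are harmless: everything below only uses membership).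
Diagram : Set
Diagram = List Cell

Positive : Diagram → Set
Positive D = All (λ p → (1 ≤ proj₁ p) × (1 ≤ proj₂ p)) D

mem : ℕ → ℕ → Diagram → Bool
mem r c D = any (λ p → (proj₁ p ≡ᵇ r) ∧ (proj₂ p ≡ᵇ c)) D

_≈D_ : Diagram → Diagram → Set
D ≈D E = ∀ r c → mem r c D ≡ mem r c E

bound : Diagram → ℕ
bound = foldr (λ p m → proj₁ p ⊔ proj₂ p ⊔ m) 0

-- wt(D): the i-th entry is the number of cells of D in row i
-- (all cells of D lie in columns 0 .. bound D).
wt : Diagram → ℕ → ℕ
wt D r = length (filter (λ c → mem r c D Data.Bool.≟ true) (applyUpTo (λ c → c) (suc (bound D))))

remove : ℕ → ℕ → Diagram → Diagram
remove r c D = filter (λ p → not ((proj₁ p ≡ᵇ r) ∧ (proj₂ p ≡ᵇ c)) Data.Bool.≟ true) D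

-- Search for the target row r' of a ladder move below row i at (r , c):
-- r' is the largest s with i ≤ s < r such that (s,c),(s,c+1) are not both in D;
-- the move exists iff at this s both (s,c),(s,c+1) ∉ D.
-- (Checks s = start, start-1, ... using the given fuel.)
searchTarget : Diagram → ℕ → ℕ → ℕ → Maybe ℕ
searchTarget D c zero s = nothing
searchTarget D c (suc f) s with mem s c D | mem s (suc c) D
... | true  | true  = searchTarget D c f (s ∸ 1)
... | false | false = just s
... | _     | _     = nothing

-- ladderTarget D i c r = just r'  iff  a ladder move below row i can be
-- performed at (r , c) ∈ D, and then (r , c) is moved to (r' , c+1).
ladderTarget : Diagram → ℕ → ℕ → ℕ → Maybe ℕ
ladderTarget D i c r with mem r c D | mem r (suc c) D
... | true | false = searchTarget D c (r ∸ i) (r ∸ 1)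
... | _    | _     = nothing

-- One scanning pass over the rows in the given list (top to bottom),
-- performing regular ladder moves; returns the current diagram and the list
-- of moves (r , r') performed, in scan order: (r , c) was moved to (r' , c+1).
scan : ℕ → ℕ → List ℕ → Diagram → Diagram × List (ℕ × ℕ)
scan i c [] D = D , []
scan i c (r ∷ rs) D with ladderTarget D i c r
... | nothing = scan i c rs D
... | just r' with scan i c rs ((r' , suc c) ∷ remove r c D)
...   | E , ms = E , ((r , r') ∷ ms)

rowsToScan : ℕ → Diagram → List ℕ
rowsToScan i D = applyUpTo (i +_) (suc (bound D) ∸ i)

-- The cells moved by L_{i,c}, as pairs (r , r'): (r , c) moved to (r' , c+1).
movesL : ℕ → ℕ → Diagram → List (ℕ × ℕ)
movesL i c D = proj₂ (scan i c (rowsToScan i D) D)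

lastRow : ℕ → List (ℕ × ℕ) → ℕ
lastRow d [] = d
lastRow d ((r , _) ∷ ms) = lastRow r ms

-- L_{i,c}(D): do all regular moves; if at least one move was performed, the
-- last one becomes a K-ladder move, i.e. its source cell (r_k , c) is kept.
L : ℕ → ℕ → Diagram → Diagram
L i c D with scan i c (rowsToScan i D) D
... | E , []       = E
... | E , (m ∷ ms) = (lastRow (proj₁ m) ms , c) ∷ E

ActsInitially : ℕ → ℕ → Diagram → Set
ActsInitially i c D = L (suc i) c D ≈D D

Chained : ℕ → List (ℕ × ℕ) → Set
Chained prev [] = ⊤
Chained prev ((r , t) ∷ ms) = (t ≡ prev) × Chained r ms

-- Since L_{i+1,c} fixes D, no ladder move below row i+1 exists in column c, so every
-- ladder move below row i in column c lands in row i itself. After (r₁,c) has moved to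
-- (r₀,c+1) with r₀ = i, the cells (r₁,c) and (r₁,c+1) are both vacant while the rows
-- below r₁ are untouched; hence every move from a lower row now lands in row r₁, and
-- inductively (r_j,c) moves to (r_{j-1},c+1). Each regular move shifts one cell from
-- row r_j to row r_{j-1}, so the rows between telescope, and the final K-ladder move
-- puts (r_k,c) back: the net effect is one extra cell in row r₀ = i.
module Submission where

open import Defs
open import Data.Nat using (ℕ; zero; suc; _+_; _∸_; _≤_; _<_; _⊔_; _≡ᵇ_; s≤s)
open import Data.Nat.Properties
open import Data.Bool using (Bool; true; false; T; _∧_; _∨_; if_then_else_)
  renaming (_≟_ to _≟ᵇ_)
open import Data.Bool.Properties using (∨-zeroʳ)
open import Data.List using (List; []; _∷_; filter; length; applyUpTo)
open import Data.List.Membership.Propositional using (_∈_)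
open import Data.List.Membership.Propositional.Properties using (∈-applyUpTo⁺)
open import Data.List.Relation.Unary.All as All using (All; []; _∷_)
open import Data.Maybe using (just; nothing)
import Data.Maybe.Relation.Unary.All as Maybe
open import Data.Product using (_×_; _,_; proj₁; proj₂; ∃-syntax)
import Data.Product as Product
open import Data.Sum using (_⊎_; inj₁; inj₂)
import Data.Sum as Sum
open import Data.Unit using (⊤; tt)
open import Function using (_∘_; id)
open import Relation.Binary.PropositionalEquality
open import Relation.Nullary using (yes; no; does; contradiction)

≡ᵇ-refl : ∀ n → (n ≡ᵇ n) ≡ true
≡ᵇ-refl zero    = refl
≡ᵇ-refl (suc n) = ≡ᵇ-refl n

≡ᵇ-true⇒≡ : ∀ {m n} → (m ≡ᵇ n) ≡ true → m ≡ n
≡ᵇ-true⇒≡ {m} {n} eq = ≡ᵇ⇒≡ m n (subst T (sym eq) tt)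

≢⇒≡ᵇ-false : ∀ {m n} → m ≢ n → (m ≡ᵇ n) ≡ false
≢⇒≡ᵇ-false {m} {n} m≢n with m ≡ᵇ n in eq
... | false = refl
... | true  = contradiction (≡ᵇ-true⇒≡ eq) m≢n

<⇒≤∸1 : ∀ {m n} → m < n → m ≤ n ∸ 1
<⇒≤∸1 (s≤s m≤n) = m≤n

n∸m≡1+[n∸[1+m]] : ∀ {m n} → m < n → n ∸ m ≡ suc (n ∸ suc m)
n∸m≡1+[n∸[1+m]] (s≤s m≤n) = +-∸-assoc 1 m≤n

[n∸1]∸[n∸[1+m]]≡m : ∀ {m n} → m < n → n ∸ 1 ∸ (n ∸ suc m) ≡ m
[n∸1]∸[n∸[1+m]]≡m (s≤s m≤n) = m∸[m∸n]≡n m≤n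

isCell : ℕ → ℕ → Cell → Bool
isCell s k x = (proj₁ x ≡ᵇ s) ∧ (proj₂ x ≡ᵇ k)

isCell-self : ∀ s k → isCell s k (s , k) ≡ true
isCell-self s k rewrite ≡ᵇ-refl s | ≡ᵇ-refl k = refl

isCell-other : ∀ {s k} x → x ≢ (s , k) → isCell s k x ≡ false
isCell-other {s} {k} (a , b) x≢sk with a ≟ s | b ≟ k
... | yes refl | yes refl = contradiction refl x≢sk
... | no a≢s   | _        rewrite ≢⇒≡ᵇ-false a≢s = refl
... | yes refl | no b≢k   rewrite ≡ᵇ-refl a | ≢⇒≡ᵇ-false b≢k = refl

isCell⇒≡ : ∀ {s k} x → isCell s k x ≡ true → x ≡ (s , k)
isCell⇒≡ {s} {k} (a , b) h with a ≡ᵇ s in a≡s | b ≡ᵇ k in b≡k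
... | true | true = cong₂ _,_ (≡ᵇ-true⇒≡ a≡s) (≡ᵇ-true⇒≡ b≡k)

mem-here : ∀ s k E → mem s k ((s , k) ∷ E) ≡ true
mem-here s k E rewrite isCell-self s k = refl

mem-there : ∀ {s k} x E → x ≢ (s , k) → mem s k (x ∷ E) ≡ mem s k E
mem-there x E x≢sk rewrite isCell-other x x≢sk = refl

mem-remove-self : ∀ r c E → mem r c (remove r c E) ≡ false
mem-remove-self r c []      = refl
mem-remove-self r c (x ∷ E) with isCell r c x in h
... | true  = mem-remove-self r c E
... | false rewrite h = mem-remove-self r c E

mem-remove-other : ∀ {s k} r c E → (s , k) ≢ (r , c) → mem s k (remove r c E) ≡ mem s k E
mem-remove-other r c [] _ = refl
mem-remove-other {s} {k} r c (x ∷ E) sk≢rc with isCell r c x in h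
... | true with refl ← isCell⇒≡ x h
  rewrite isCell-other (r , c) (sk≢rc ∘ sym) = mem-remove-other r c E sk≢rc
... | false = cong (isCell s k x ∨_) (mem-remove-other r c E sk≢rc)

mem⇒≤bound : ∀ {r k} E → mem r k E ≡ true → r ≤ bound E × k ≤ bound E
mem⇒≤bound {r} {k} (x ∷ E) h with isCell r k x in hx
... | true with refl ← isCell⇒≡ x hx =
  ≤-trans (m≤m⊔n r k) (m≤m⊔n _ (bound E)) , ≤-trans (m≤n⊔m r k) (m≤m⊔n _ (bound E))
... | false = Product.map (λ r≤ → ≤-trans r≤ tail≤) (λ k≤ → ≤-trans k≤ tail≤) (mem⇒≤bound E h)
  where
  tail≤ : bound E ≤ bound (x ∷ E)
  tail≤ = m≤n⊔m (proj₁ x ⊔ proj₂ x) (bound E)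

move : Cell → Cell → Diagram → Diagram
move (r , c) y E = y ∷ remove r c E

mem-move-source : ∀ {r c} y E → y ≢ (r , c) → mem r c (move (r , c) y E) ≡ false
mem-move-source {r} {c} y E y≢rc = trans (mem-there y (remove r c E) y≢rc) (mem-remove-self r c E)

mem-move-other : ∀ {s k} x y E → (s , k) ≢ x → (s , k) ≢ y → mem s k (move x y E) ≡ mem s k E
mem-move-other (r , c) y E sk≢x sk≢y =
  trans (mem-there y (remove r c E) (sk≢y ∘ sym)) (mem-remove-other r c E sk≢x)

mem-move-keep : ∀ {s k} x y E → (s , k) ≢ x → mem s k E ≡ true → mem s k (move x y E) ≡ true
mem-move-keep {s} {k} (r , c) y E sk≢x sk∈E =
  trans (cong (isCell s k y ∨_) (trans (mem-remove-other r c E sk≢x) sk∈E)) (∨-zeroʳ _)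

count : (ℕ → Bool) → ℕ → ℕ
count g zero    = 0
count g (suc n) = if g zero then suc (count (g ∘ suc) n) else count (g ∘ suc) n

length-filter-applyUpTo : ∀ {A : Set} (g : A → Bool) (f : ℕ → A) n →
  length (filter (λ k → g k ≟ᵇ true) (applyUpTo f n)) ≡ count (g ∘ f) n
length-filter-applyUpTo g f zero = refl
length-filter-applyUpTo g f (suc n) with g (f zero)
... | true  = cong suc (length-filter-applyUpTo g (f ∘ suc) n)
... | false = length-filter-applyUpTo g (f ∘ suc) n

count-cong : ∀ {g h} n → (∀ k → g k ≡ h k) → count g n ≡ count h n
count-cong zero _ = refl
count-cong {g} {h} (suc n) g≗h rewrite g≗h zero with h zero
... | true  = cong suc (count-cong n (g≗h ∘ suc))
... | false = count-cong n (g≗h ∘ suc)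

count-false : ∀ {g : ℕ → Bool} n → (∀ k → g k ≡ false) → count g n ≡ 0
count-false zero _ = refl
count-false {g} (suc n) none rewrite none zero = count-false n (none ∘ suc)

count-+ : ∀ g m n → count g (m + n) ≡ count g m + count (λ k → g (m + k)) n
count-+ g zero n = refl
count-+ g (suc m) n with g zero
... | true  = cong suc (count-+ (g ∘ suc) m n)
... | false = count-+ (g ∘ suc) m n

count-update : ∀ {g h x} n → (∀ k → k ≢ x → h k ≡ g k) → g x ≡ false → h x ≡ true →
  x < n → count h n ≡ suc (count g n)
count-update {g} {h} {zero} (suc n) agree gx hx _ rewrite gx | hx =
  cong suc (count-cong n (λ k → agree (suc k) λ ()))
count-update {g} {h} {suc x} (suc n) agree gx hx (s≤s x<n) rewrite agree zero (λ ())
  with g zero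
... | true  = cong suc (count-update n (λ k k≢x → agree (suc k) (k≢x ∘ suc-injective)) gx hx x<n)
... | false = count-update n (λ k k≢x → agree (suc k) (k≢x ∘ suc-injective)) gx hx x<n

rowCount : ℕ → Diagram → ℕ → ℕ
rowCount N E s = count (λ k → mem s k E) N

wt≡rowCount : ∀ {N} E s → bound E < N → wt E s ≡ rowCount N E s
wt≡rowCount {N} E s bound<N = begin
  wt E s                                ≡⟨ length-filter-applyUpTo row id (suc (bound E)) ⟩
  count row (suc (bound E))             ≡⟨ +-identityʳ _ ⟨
  count row (suc (bound E)) + 0
                                        ≡⟨ cong (count row (suc (bound E)) +_) (count-false (N ∸ suc (bound E)) beyond) ⟨
  count row (suc (bound E)) + count (λ k → row (suc (bound E) + k)) (N ∸ suc (bound E))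
                                        ≡⟨ count-+ row (suc (bound E)) (N ∸ suc (bound E)) ⟨
  count row (suc (bound E) + (N ∸ suc (bound E)))
                                        ≡⟨ cong (count row) (m+[n∸m]≡n bound<N) ⟩
  rowCount N E s                        ∎
  where
  open ≡-Reasoning
  row : ℕ → Bool
  row k = mem s k E
  beyond : ∀ k → row (suc (bound E) + k) ≡ false
  beyond k with row (suc (bound E) + k) in h
  ... | false = refl
  ... | true  =
    contradiction (m+n≤o⇒m≤o (suc (bound E)) (proj₂ (mem⇒≤bound E h))) (n≮n (bound E))

-- `does (s ≟ r)` computes to `s ≡ᵇ r`, which +δ≡if relies on.
δ : ℕ → ℕ → ℕ
δ s r = if s ≡ᵇ r then 1 else 0

δ-self : ∀ s → δ s s ≡ 1
δ-self s rewrite ≡ᵇ-refl s = refl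

δ-other : ∀ {s r} → s ≢ r → δ s r ≡ 0
δ-other s≢r rewrite ≢⇒≡ᵇ-false s≢r = refl

+δ≡if : ∀ x s r → x + δ s r ≡ (if does (s ≟ r) then suc x else x)
+δ≡if x s r with s ≡ᵇ r
... | true  = +-comm x 1
... | false = +-identityʳ x

rowCount-add : ∀ {a b N} E s → mem a b E ≡ false → b < N →
  rowCount N ((a , b) ∷ E) s ≡ rowCount N E s + δ s a
rowCount-add {a} {b} {N} E s ab∉E b<N with s ≟ a
... | yes refl = trans
  (count-update {x = b} N (λ k k≢b → mem-there (s , b) E (k≢b ∘ sym ∘ cong proj₂))
                ab∉E (mem-here s b E) b<N)
  (trans (+-comm 1 _) (cong (rowCount N E s +_) (sym (δ-self s))))
... | no s≢a = trans (count-cong N (λ k → mem-there (a , b) E (s≢a ∘ sym ∘ cong proj₁)))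
                     (trans (sym (+-identityʳ _)) (cong (rowCount N E s +_) (sym (δ-other s≢a))))

rowCount-remove : ∀ {a b N} E s → mem a b E ≡ true → b < N →
  rowCount N (remove a b E) s + δ s a ≡ rowCount N E s
rowCount-remove {a} {b} {N} E s ab∈E b<N with s ≟ a
... | yes refl = trans (cong (rowCount N (remove s b E) s +_) (δ-self s)) (trans (+-comm _ 1) (sym
  (count-update {x = b} N (λ k k≢b → sym (mem-remove-other s b E (k≢b ∘ cong proj₂)))
                (mem-remove-self s b E) ab∈E b<N)))
... | no s≢a = trans (cong (rowCount N (remove a b E) s +_) (δ-other s≢a))
  (trans (+-identityʳ _) (count-cong N (λ k → mem-remove-other a b E (s≢a ∘ cong proj₁))))

rowCount-move : ∀ {r c r′ c′ N} E s → mem r c E ≡ true → mem r′ c′ E ≡ false →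
  c < N → c′ < N →
  rowCount N (move (r , c) (r′ , c′) E) s + δ s r ≡ rowCount N E s + δ s r′
rowCount-move {r} {c} {r′} {c′} {N} E s rc∈E r′c′∉E c<N c′<N = begin
  rowCount N ((r′ , c′) ∷ remove r c E) s + δ s r
    ≡⟨ cong (_+ δ s r) (rowCount-add (remove r c E) s r′c′∉E′ c′<N) ⟩
  rowCount N (remove r c E) s + δ s r′ + δ s r
    ≡⟨ +-assoc _ (δ s r′) (δ s r) ⟩
  rowCount N (remove r c E) s + (δ s r′ + δ s r)
    ≡⟨ cong (rowCount N (remove r c E) s +_) (+-comm (δ s r′) (δ s r)) ⟩
  rowCount N (remove r c E) s + (δ s r + δ s r′)
    ≡⟨ +-assoc _ (δ s r) (δ s r′) ⟨
  rowCount N (remove r c E) s + δ s r + δ s r′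
    ≡⟨ cong (_+ δ s r′) (rowCount-remove E s rc∈E c<N) ⟩
  rowCount N E s + δ s r′ ∎
  where
  open ≡-Reasoning
  distinct : (r′ , c′) ≢ (r , c)
  distinct refl = contradiction (trans (sym rc∈E) r′c′∉E) λ ()
  r′c′∉E′ : mem r′ c′ (remove r c E) ≡ false
  r′c′∉E′ = trans (mem-remove-other r c E distinct) r′c′∉E

searchTarget-sound : ∀ {E c t} f s → searchTarget E c f s ≡ just t →
  mem t (suc c) E ≡ false × t ≤ s
searchTarget-sound {E} {c} (suc f) s found with mem s c E | mem s (suc c) E in s₁∉E
... | true  | true  =
  Product.map₂ (λ t≤ → ≤-trans t≤ (m∸n≤m s 1)) (searchTarget-sound f (s ∸ 1) found)
... | false | false with refl ← found = s₁∉E , ≤-refl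
... | true  | false with () ← found
... | false | true  with () ← found

searchTarget-suc : ∀ E c f s →
  searchTarget E c (suc f) s ≡ searchTarget E c f s ⊎ searchTarget E c (suc f) s ≡ just (s ∸ f)
searchTarget-suc E c zero s with mem s c E | mem s (suc c) E
... | true  | true  = inj₁ refl
... | true  | false = inj₁ refl
... | false | true  = inj₁ refl
... | false | false = inj₂ refl
searchTarget-suc E c (suc f) s with mem s c E | mem s (suc c) E
... | true  | true  = Sum.map₂ (λ found → trans found (cong just (∸-+-assoc s 1 f)))
                           (searchTarget-suc E c f (s ∸ 1))
... | true  | false = inj₁ refl
... | false | true  = inj₁ refl
... | false | false = inj₁ refl

-- Maybe.All (r <_) m: the search m did not get up to row r.
searchTarget-above : ∀ {E E′ c r} f s → r ≤ s →
  (∀ s′ k → r < s′ → mem s′ k E′ ≡ mem s′ k E) →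
  mem r c E′ ≡ false → mem r (suc c) E′ ≡ false →
  searchTarget E′ c f s ≡ just r ⊎
  (searchTarget E′ c f s ≡ searchTarget E c f s × Maybe.All (r <_) (searchTarget E′ c f s))
searchTarget-above zero s _ _ _ _ = inj₂ (refl , Maybe.nothing)
searchTarget-above {E} {E′} {c} {r} (suc f) s r≤s agree rc∉ rc₁∉ with m≤n⇒m<n∨m≡n r≤s
... | inj₂ refl rewrite rc∉ | rc₁∉ = inj₁ refl
... | inj₁ r<s rewrite agree s c r<s | agree s (suc c) r<s with mem s c E | mem s (suc c) E
...   | true  | true  = searchTarget-above f (s ∸ 1) (<⇒≤∸1 r<s) agree rc∉ rc₁∉
...   | false | false = inj₂ (refl , Maybe.just r<s)
...   | true  | false = inj₂ (refl , Maybe.nothing)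
...   | false | true  = inj₂ (refl , Maybe.nothing)

ladderTarget-search : ∀ E i c r → mem r c E ≡ true → mem r (suc c) E ≡ false →
  ladderTarget E i c r ≡ searchTarget E c (r ∸ i) (r ∸ 1)
ladderTarget-search E i c r rc∈E rc₁∉E rewrite rc∈E | rc₁∉E = refl

ladderTarget-sound : ∀ E i c r {t} → ladderTarget E i c r ≡ just t →
  mem r c E ≡ true × mem r (suc c) E ≡ false × mem t (suc c) E ≡ false × t < r
ladderTarget-sound E i c r {t} found with mem r c E | mem r (suc c) E
... | true  | false = refl , refl , proj₁ (searchTarget-sound (r ∸ i) (r ∸ 1) found) , below r found
  where
  below : ∀ r → searchTarget E c (r ∸ i) (r ∸ 1) ≡ just t → t < r
  below zero found′ with () ← subst (λ f → searchTarget E c f 0 ≡ just t) (0∸n≡0 i) found′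
  below (suc r) found′ = s≤s (proj₂ (searchTarget-sound (suc r ∸ i) r found′))
... | true  | true  with () ← found
... | false | _     with () ← found

ladderTarget-floor : ∀ E i c r → r ≤ i → ladderTarget E i c r ≡ nothing
ladderTarget-floor E i c r r≤i with mem r c E | mem r (suc c) E
... | true  | false rewrite m≤n⇒m∸n≡0 r≤i = refl
... | true  | true  = refl
... | false | _     = refl

ladderTarget-lower : ∀ E i c r →
  ladderTarget E i c r ≡ ladderTarget E (suc i) c r ⊎ ladderTarget E i c r ≡ just i
ladderTarget-lower E i c r with mem r c E | mem r (suc c) E
... | true  | true  = inj₁ refl
... | false | _     = inj₁ refl
... | true  | false with r ≤? i
...   | yes r≤i rewrite m≤n⇒m∸n≡0 r≤i | m≤n⇒m∸n≡0 (m≤n⇒m≤1+n r≤i) = inj₁ refl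
...   | no r≰i rewrite n∸m≡1+[n∸[1+m]] (≰⇒> r≰i) =
  Sum.map₂ (λ found → trans found (cong just ([n∸1]∸[n∸[1+m]]≡m (≰⇒> r≰i))))
           (searchTarget-suc E c (r ∸ suc i) (r ∸ 1))

LandsIn : ℕ → ℕ → Diagram → ℕ → ℕ → Set
LandsIn i c E p from = ∀ r → from ≤ r →
  ladderTarget E i c r ≡ nothing ⊎ ladderTarget E i c r ≡ just p

module _ {i c E p r} (moved : ladderTarget E i c r ≡ just p) where
  private
    E′ : Diagram
    E′ = move (r , c) (p , suc c) E
    p<r : p < r
    p<r = proj₂ (proj₂ (proj₂ (ladderTarget-sound E i c r moved)))
    agree : ∀ s k → r < s → mem s k E′ ≡ mem s k E
    agree s k r<s = mem-move-other (r , c) (p , suc c) E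
      (λ eq → <-irrefl (sym (cong proj₁ eq)) r<s)
      (λ eq → <-irrefl (sym (cong proj₁ eq)) (<-trans p<r r<s))
    rc₁∉E′ : mem r (suc c) E′ ≡ false
    rc₁∉E′ = trans (mem-move-other (r , c) (p , suc c) E (1+n≢n ∘ cong proj₂)
                                   (λ eq → <-irrefl (sym (cong proj₁ eq)) p<r))
                   (proj₁ (proj₂ (ladderTarget-sound E i c r moved)))

  move-vacates-source : mem r c (move (r , c) (p , suc c) E) ≡ false
  move-vacates-source = mem-move-source (p , suc c) E (λ eq → <-irrefl (cong proj₁ eq) p<r)

  LandsIn-move : ∀ {from} → LandsIn i c E p from → from ≤ r →
    LandsIn i c (move (r , c) (p , suc c) E) r (suc r)
  LandsIn-move lands from≤r r′ r<r′ with ladderTarget E′ i c r′ in found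
  ... | nothing = inj₁ refl
  ... | just t with ladderTarget-sound E′ i c r′ found
  ...   | r′c∈E′ , r′c₁∉E′ , _
    with ladderTarget-search E′ i c r′ r′c∈E′ r′c₁∉E′
       | ladderTarget-search E i c r′ (trans (sym (agree r′ c r<r′)) r′c∈E′)
                                     (trans (sym (agree r′ (suc c) r<r′)) r′c₁∉E′)
       | searchTarget-above (r′ ∸ i) (r′ ∸ 1) (<⇒≤∸1 r<r′) agree move-vacates-source rc₁∉E′
  ...     | inE′ | _ | inj₁ atR = inj₂ (trans (sym found) (trans inE′ atR))
  ...     | inE′ | inE | inj₂ (same , above) with lands r′ (≤-trans from≤r (<⇒≤ r<r′))
  ...       | inj₁ none =
    contradiction (trans (sym found) (trans inE′ (trans same (trans (sym inE) none)))) λ ()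
  ...       | inj₂ atP =
    contradiction (Maybe.drop-just (subst (Maybe.All (r <_)) (trans same (trans (sym inE) atP)) above))
                  (<⇒≯ p<r)

scan-keeps-outside : ∀ {t k} i c rs E → k ≢ c → mem t k E ≡ true →
  mem t k (proj₁ (scan i c rs E)) ≡ true
scan-keeps-outside i c [] E _ tk∈E = tk∈E
scan-keeps-outside {t} {k} i c (r ∷ rs) E k≢c tk∈E with ladderTarget E i c r
... | nothing = scan-keeps-outside i c rs E k≢c tk∈E
... | just r′
  with scan i c rs (move (r , c) (r′ , suc c) E)
     | scan-keeps-outside i c rs (move (r , c) (r′ , suc c) E) k≢c
         (mem-move-keep (r , c) (r′ , suc c) E (k≢c ∘ cong proj₂) tk∈E)
...   | _ , _ | kept = kept

scan-stuck⊎fills : ∀ i c rs E →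
  All (λ r → ladderTarget E i c r ≡ nothing) rs ⊎
  ∃[ t ] (mem t (suc c) E ≡ false × mem t (suc c) (proj₁ (scan i c rs E)) ≡ true)
scan-stuck⊎fills i c [] E = inj₁ []
scan-stuck⊎fills i c (r ∷ rs) E with ladderTarget E i c r in found
... | nothing = Sum.map₁ (found ∷_) (scan-stuck⊎fills i c rs E)
... | just t
  with scan i c rs (move (r , c) (t , suc c) E)
     | scan-keeps-outside i c rs (move (r , c) (t , suc c) E) 1+n≢n (mem-here t (suc c) (remove r c E))
...   | _ , _ | filled = inj₂ (t , proj₁ (proj₂ (proj₂ (ladderTarget-sound E i c r found))) , filled)

scan⊆L : ∀ {t k} i c D → mem t k (proj₁ (scan i c (rowsToScan i D) D)) ≡ true →
  mem t k (L i c D) ≡ true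
scan⊆L i c D tk∈F with scan i c (rowsToScan i D) D
... | _ , []    = tk∈F
... | _ , _ ∷ _ = trans (cong (_ ∨_) tk∈F) (∨-zeroʳ _)

actsInitially⇒stuck : ∀ {i c D} → ActsInitially i c D →
  All (λ r → ladderTarget D (suc i) c r ≡ nothing) (rowsToScan (suc i) D)
actsInitially⇒stuck {i} {c} {D} fixed with scan-stuck⊎fills (suc i) c (rowsToScan (suc i) D) D
... | inj₁ stuck = stuck
... | inj₂ (t , vacant , filled) =
  contradiction (trans (sym vacant) (trans (sym (fixed t (suc c))) (scan⊆L (suc i) c D filled))) λ ()

∈-rowsToScan : ∀ {i r} D → i ≤ r → r ≤ bound D → r ∈ rowsToScan i D
∈-rowsToScan {i} D i≤r r≤bound = subst (_∈ rowsToScan i D) (m+[n∸m]≡n i≤r)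
  (∈-applyUpTo⁺ (i +_) (∸-monoˡ-< (s≤s r≤bound) i≤r))

actsInitially⇒no-move : ∀ {i c D} → ActsInitially i c D →
  ∀ r → ladderTarget D (suc i) c r ≡ nothing
actsInitially⇒no-move {i} {c} {D} fixed r with r ≤? i
... | yes r≤i = ladderTarget-floor D (suc i) c r (m≤n⇒m≤1+n r≤i)
... | no r≰i with ladderTarget D (suc i) c r in found
...   | nothing = refl
...   | just _  = trans (sym found) (All.lookup (actsInitially⇒stuck {i} {c} {D} fixed)
  (∈-rowsToScan D (≰⇒> r≰i) (proj₁ (mem⇒≤bound D rc∈D))))
  where
  rc∈D : mem r c D ≡ true
  rc∈D = proj₁ (ladderTarget-sound D (suc i) c r found)

actsInitially⇒LandsIn : ∀ {i c D} → ActsInitially i c D → LandsIn i c D i i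
actsInitially⇒LandsIn {i} {c} {D} fixed r _ =
  Sum.map₁ (λ same → trans same (actsInitially⇒no-move {i} {c} {D} fixed r))
           (ladderTarget-lower D i c r)

AscendingFrom : ℕ → List ℕ → Set
AscendingFrom from []       = ⊤
AscendingFrom from (r ∷ rs) = from ≤ r × AscendingFrom (suc r) rs

applyUpTo-ascending : ∀ {from} f n → (∀ k → f k < f (suc k)) → from ≤ f zero →
  AscendingFrom from (applyUpTo f n)
applyUpTo-ascending f zero    _   _       = tt
applyUpTo-ascending f (suc n) inc from≤f0 =
  from≤f0 , applyUpTo-ascending (f ∘ suc) n (inc ∘ suc) (inc zero)

rowsToScan-ascending : ∀ i D → AscendingFrom i (rowsToScan i D)
rowsToScan-ascending i D =
  applyUpTo-ascending (i +_) _ (λ k → +-monoʳ-< i (n<1+n k)) (m≤m+n i 0)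

-- p is the row in which the next ladder move lands: the row of the cell moved last,
-- or i before the first move.
record ScanSpec (c : ℕ) (E : Diagram) (p : ℕ) (F : Diagram) (ms : List (ℕ × ℕ)) : Set where
  field
    chained          : Chained p ms
    last-vacated     : mem p c E ≡ false → mem (lastRow p ms) c F ≡ false
    moved-vacated    : ms ≢ [] → mem (lastRow p ms) c F ≡ false
    rowCount-balance : ∀ {N} → suc c < N → ∀ s →
                       rowCount N F s + δ s (lastRow p ms) ≡ rowCount N E s + δ s p

scan-spec : ∀ {i c} rs {E p from} → AscendingFrom from rs → LandsIn i c E p from →
  ScanSpec c E p (proj₁ (scan i c rs E)) (proj₂ (scan i c rs E))
scan-spec [] _ _ = record
  { chained          = tt
  ; last-vacated     = id
  ; moved-vacated    = λ []≢[] → contradiction refl []≢[]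
  ; rowCount-balance = λ _ _ → refl
  }
scan-spec {i} {c} (r ∷ rs) {E} {p} (from≤r , ascending) lands with ladderTarget E i c r in found
... | nothing = scan-spec rs ascending (λ r′ r<r′ → lands r′ (≤-trans from≤r (<⇒≤ r<r′)))
... | just t with lands r from≤r
...   | inj₁ none = contradiction (trans (sym found) none) λ ()
...   | inj₂ atP with refl ← trans (sym found) atP | ladderTarget-sound E i c r found
...   | rc∈E , _ , pc₁∉E , _
  with scan i c rs (move (r , c) (p , suc c) E)
     | scan-spec {i} {c} rs {move (r , c) (p , suc c) E} ascending
         (LandsIn-move {E = E} {r = r} found lands from≤r)
...     | F , ms | spec = record
  { chained          = refl , chained
  ; last-vacated     = λ _ → last-vacated (move-vacates-source {E = E} {r = r} found)
  ; moved-vacated    = λ _ → last-vacated (move-vacates-source {E = E} {r = r} found)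
  ; rowCount-balance = λ {N} c₁<N s → trans (rowCount-balance c₁<N s)
      (rowCount-move E s rc∈E pc₁∉E (<-trans (n<1+n c) c₁<N) c₁<N)
  }
  where open ScanSpec spec

scan-spec-L : ∀ {i c D} → ActsInitially i c D →
  ScanSpec c D i (proj₁ (scan i c (rowsToScan i D) D)) (proj₂ (scan i c (rowsToScan i D) D))
scan-spec-L {i} {c} {D} fixed =
  scan-spec (rowsToScan i D) (rowsToScan-ascending i D) (actsInitially⇒LandsIn fixed)

wt-after-ladderMoves : ∀ {c D i F r₁ t₁ ms} → ScanSpec c D i F ((r₁ , t₁) ∷ ms) →
  ∀ s → wt ((lastRow r₁ ms , c) ∷ F) s ≡ wt D s + δ s i
wt-after-ladderMoves {c} {D} {i} {F} {r₁} {t₁} {ms} spec s = begin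
  wt L′ s                        ≡⟨ wt≡rowCount L′ s L′<N ⟩
  rowCount N L′ s                ≡⟨ rowCount-add F s (moved-vacated λ ()) (<-trans (n<1+n c) c₁<N) ⟩
  rowCount N F s + δ s lr        ≡⟨ rowCount-balance c₁<N s ⟩
  rowCount N D s + δ s i         ≡⟨ cong (_+ δ s i) (wt≡rowCount D s D<N) ⟨
  wt D s + δ s i                 ∎
  where
  open ≡-Reasoning
  open ScanSpec spec
  lr : ℕ
  lr = lastRow r₁ ms
  L′ : Diagram
  L′ = (lr , c) ∷ F
  N : ℕ
  N = suc (bound L′ + bound D + suc c)
  L′<N : bound L′ < N
  L′<N = s≤s (≤-trans (m≤m+n (bound L′) (bound D)) (m≤m+n _ (suc c)))
  D<N : bound D < N
  D<N = s≤s (≤-trans (m≤n+m (bound D) (bound L′)) (m≤m+n _ (suc c)))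
  c₁<N : suc c < N
  c₁<N = s≤s (m≤n+m (suc c) _)

wt-L : ∀ {i c D} →
  ScanSpec c D i (proj₁ (scan i c (rowsToScan i D) D)) (proj₂ (scan i c (rowsToScan i D) D)) →
  proj₂ (scan i c (rowsToScan i D) D) ≢ [] → ∀ s → wt (L i c D) s ≡ wt D s + δ s i
wt-L {i} {c} {D} spec moved s with scan i c (rowsToScan i D) D
... | _ , []    = contradiction refl moved
... | _ , _ ∷ _ = wt-after-ladderMoves spec s

lemma5p6 : (D : Diagram) → Positive D → (i c : ℕ) → 1 ≤ i → 1 ≤ c →
    ActsInitially i c D → movesL i c D ≢ [] →
    Chained i (movesL i c D) ×
    (∀ r → wt (L i c D) r ≡ (if does (r ≟ i) then suc (wt D r) else wt D r))
lemma5p6 D _ i c _ _ fixed moved = ScanSpec.chained (scan-spec-L fixed) ,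
  λ r → trans (wt-L (scan-spec-L fixed) moved r) (+δ≡if (wt D r) r i)
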